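{- If $\xi < \omega_1$ then every set $C \subseteq 2^\xi$ is countably $\leq_{\mathrm{lex}}$-cofinal, that is, there is an at most countable set $C' \subseteq C$ such that for every $s \in C$ there is $t \in C'$ with $s \leq_{\mathrm{lex}} t$.
   Context: For an ordinal $\xi$, $2^\xi$ is the set of all binary sequences (functions $\xi \to \{0,1\}$) of length exactly $\xi$. For $s,t \in 2^\xi$, $s \leq_{\mathrm{lex}} t$ iff either $s = t$ or the least ordinal $\eta < \xi$ with $s(\eta) \neq t(\eta)$ satisfies $s(\eta) < t(\eta)$ (the lexicographical order). -}

module Defs where

open import Data.Nat using (ℕ)
open import Data.Bool using (Bool; true; false)
open import Data.Maybe using (Maybe; just)
open import Data.Product using (Σ; _×_; ∃-syntax)
open import Data.Sum using (_⊎_)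
open import Relation.Nullary using (Dec)
open import Relation.Binary.PropositionalEquality using (_≡_)
open import Relation.Binary.Structures using (IsStrictPartialOrder)
open import Induction.WellFounded using (WellFounded)
open import Function.Definitions using (Injective)

-- Classical logic (the paper's ambient ZFC): every proposition is decided.
LEM : Set₁
LEM = (P : Set) → Dec P

-- A countable ordinal ξ < ω₁, presented as a countable well-ordered set:
-- a strict, total (trichotomous), well-founded order on a carrier that
-- injects into ℕ. Every ordinal < ω₁ is the order type of such a structure.
record CountableOrdinal : Set₁ where
  field
    Carrier   : Set
    _<_       : Carrier → Carrier → Set
    isSPO     : IsStrictPartialOrder _≡_ _<_
    total     : ∀ x y → (x < y) ⊎ ((x ≡ y) ⊎ (y < x))
    wf        : WellFounded _<_
    code      : Carrier → ℕ
    code-inj  : Injective _≡_ _≡_ code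

module _ (ξ : CountableOrdinal) where
  open CountableOrdinal ξ

  2^ : Set
  2^ = Carrier → Bool

  _≈seq_ : 2^ → 2^ → Set
  s ≈seq t = ∀ η → s η ≡ t η

  _≤lex_ : 2^ → 2^ → Set
  s ≤lex t = (s ≈seq t) ⊎
    (∃[ η ] (((∀ ζ → ζ < η → s ζ ≡ t ζ) × (s η ≡ false)) × (t η ≡ true)))

  -- C ⊆ 2^ξ is countably ≤lex-cofinal: there is an at most countable
  -- C' ⊆ C (the set of values of an enumeration e : ℕ → Maybe 2^ξ, where
  -- `nothing` entries are skipped, allowing C' empty or finite) such that
  -- every s ∈ C is ≤lex some t ∈ C'.
  CountablyCofinal : (2^ → Set) → Set
  CountablyCofinal C =
    Σ (ℕ → Maybe 2^) λ e →
      ((∀ n t → e n ≡ just t → C t) ×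
       (∀ s → C s → ∃[ n ] ∃[ t ] ((e n ≡ just t) × (_≤lex_ s t))))

module Submission where

-- Build the lexicographic supremum `lexSup` of C greedily, by
-- well-founded recursion along ξ: lexSup(η) = 1 iff some s ∈ C agrees with
-- lexSup below η and has s(η) = 1.  For every η with lexSup(η) = 1 choose
-- such a witness, and choose one more element of C equal to lexSup if there
-- is one.  These are countably many choices, indexed by Maybe Carrier, so they
-- can be enumerated through the injective code of ξ.  Given s ∈ C, either
-- s = lexSup (covered by the extra choice), or s first differs from lexSup at
-- some η.  By the greedy construction s(η) = 1 would force lexSup(η) = 1, so
-- s(η) = 0 and lexSup(η) = 1, and the witness chosen at η is ≥lex s.

open import Defs
open import Data.Nat using (ℕ; zero; suc)
open import Data.Nat.Properties using (suc-injective)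
open import Data.Bool using (Bool; true; false)
open import Data.Bool.Properties using (_≟_)
open import Data.Maybe using (Maybe; just; nothing)
open import Data.Product using (Σ; _×_; _,_; ∃-syntax; proj₁)
open import Data.Sum using (_⊎_; inj₁; inj₂)
open import Function.Bundles using (mk⇔)
open import Function.Definitions using (Injective)
open import Relation.Nullary using (Dec; yes; no; ¬_; does; contradiction)
open import Relation.Nullary.Decidable using (dec-true; does-⇔; decidable-stable)
open import Relation.Binary.PropositionalEquality using (_≡_; _≢_; refl; sym; trans; cong)
open import Induction.WellFounded using (WellFounded; Acc; acc; module FixPoint; module All)

does-true : ∀ {A : Set} (d : Dec A) → does d ≡ true → A
does-true (yes a) _ = a

distinct-bools : ∀ {x y : Bool} → x ≢ y → (x ≡ false × y ≡ true) ⊎ (x ≡ true × y ≡ false)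
distinct-bools {false} {false} x≢y = contradiction refl x≢y
distinct-bools {false} {true}  _   = inj₁ (refl , refl)
distinct-bools {true}  {false} _   = inj₂ (refl , refl)
distinct-bools {true}  {true}  x≢y = contradiction refl x≢y

module _ (lem : LEM) where

  choose : ∀ {A : Set} → (A → Set) → Maybe A
  choose {A} P with lem (Σ A P)
  ... | yes (a , _) = just a
  ... | no _        = nothing

  choose-sound : ∀ {A : Set} (P : A → Set) {a : A} → choose P ≡ just a → P a
  choose-sound {A} P with lem (Σ A P)
  ... | yes (a , pa) = λ { refl → pa }
  ... | no _         = λ ()

  choose-complete : ∀ {A : Set} (P : A → Set) → Σ A P → ∃[ a ] (choose P ≡ just a × P a)
  choose-complete {A} P w with lem (Σ A P)
  ... | yes (a , pa) = a , refl , pa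
  ... | no none      = contradiction w none

  minimal-or-none : ∀ {A : Set} {_<_ : A → A → Set} → WellFounded _<_ → (P : A → Set) →
                    (∃[ x ] (P x × (∀ y → y < x → ¬ P y))) ⊎ (∀ x → ¬ P x)
  minimal-or-none {A} {_<_} wf P with lem (∃[ x ] (P x × (∀ y → y < x → ¬ P y)))
  ... | yes minimal = inj₁ minimal
  ... | no  none    = inj₂ (λ x → absent x (wf x))
    where
    absent : ∀ x → Acc _<_ x → ¬ P x
    absent x (acc below) px = none (x , px , λ y y<x → absent y (below y<x))

  first-difference : ∀ {A : Set} {_<_ : A → A → Set} → WellFounded _<_ → (s t : A → Bool) →
                     (∃[ x ] ((∀ y → y < x → s y ≡ t y) × s x ≢ t x)) ⊎ (∀ x → s x ≡ t x)
  first-difference wf s t with minimal-or-none wf (λ x → s x ≢ t x)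
  ... | inj₁ (x , s≢t , below) =
        inj₁ (x , (λ y y<x → decidable-stable (s y ≟ t y) (below y y<x)) , s≢t)
  ... | inj₂ none = inj₂ (λ x → decidable-stable (s x ≟ t x) (none x))

  module Enumeration {I A : Set} (code : I → ℕ) (code-inj : Injective _≡_ _≡_ code)
                     (f : I → Maybe A) where

    enum : ℕ → Maybe A
    enum n with lem (∃[ i ] (code i ≡ n))
    ... | yes (i , _) = f i
    ... | no _        = nothing

    enum-code : ∀ i → enum (code i) ≡ f i
    enum-code i with lem (∃[ j ] (code j ≡ code i))
    ... | yes (j , same) = cong f (code-inj same)
    ... | no none        = contradiction (i , refl) none

    enum-values : ∀ n {a} → enum n ≡ just a → ∃[ i ] (f i ≡ just a)
    enum-values n with lem (∃[ i ] (code i ≡ n))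
    ... | yes (i , _) = λ fi≡a → i , fi≡a
    ... | no _        = λ ()

maybe-code : ∀ {I : Set} → (I → ℕ) → Maybe I → ℕ
maybe-code code nothing  = zero
maybe-code code (just i) = suc (code i)

maybe-code-injective : ∀ {I : Set} {code : I → ℕ} → Injective _≡_ _≡_ code →
                       Injective _≡_ _≡_ (maybe-code code)
maybe-code-injective inj {nothing} {nothing} _  = refl
maybe-code-injective inj {just i}  {just j}  eq = cong just (inj (suc-injective eq))

module LexSupremum (lem : LEM) (ξ : CountableOrdinal) (C : 2^ ξ → Set) where
  open CountableOrdinal ξ

  AgreesBelow : Carrier → 2^ ξ → 2^ ξ → Set
  AgreesBelow η s t = ∀ ζ → ζ < η → s ζ ≡ t ζ

  Realises : (η : Carrier) → (∀ {ζ} → ζ < η → Bool) → 2^ ξ → Set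
  Realises η prefix s = C s × ((∀ ζ (ζ<η : ζ < η) → s ζ ≡ prefix ζ<η) × s η ≡ true)

  greedy-step : (η : Carrier) → (∀ {ζ} → ζ < η → Bool) → Bool
  greedy-step η prefix = does (lem (Σ (2^ ξ) (Realises η prefix)))

  greedy-step-ext : ∀ η {p q : ∀ {ζ} → ζ < η → Bool} →
                    (∀ {ζ} (ζ<η : ζ < η) → p ζ<η ≡ q ζ<η) → greedy-step η p ≡ greedy-step η q
  greedy-step-ext η p≗q =
    does-⇔ (mk⇔ (follow p≗q) (follow (λ ζ<η → sym (p≗q ζ<η)))) (lem _) (lem _)
    where
    follow : ∀ {p q : ∀ {ζ} → ζ < η → Bool} → (∀ {ζ} (ζ<η : ζ < η) → p ζ<η ≡ q ζ<η) →
             Σ (2^ ξ) (Realises η p) → Σ (2^ ξ) (Realises η q)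
    follow p≗q (s , Cs , agree , sη) = s , Cs , (λ ζ ζ<η → trans (agree ζ ζ<η) (p≗q ζ<η)) , sη

  open FixPoint wf (λ _ → Bool) greedy-step greedy-step-ext using (unfold-wfRec)

  lexSup : 2^ ξ
  lexSup = All.wfRec wf _ (λ _ → Bool) greedy-step

  WitnessAt : Carrier → 2^ ξ → Set
  WitnessAt η = Realises η (λ {ζ} _ → lexSup ζ)

  lexSup-unfold : ∀ η → lexSup η ≡ does (lem (Σ (2^ ξ) (WitnessAt η)))
  lexSup-unfold η = unfold-wfRec

  lexSup-witnessed : ∀ {η} → lexSup η ≡ true → Σ (2^ ξ) (WitnessAt η)
  lexSup-witnessed {η} one = does-true (lem _) (trans (sym (lexSup-unfold η)) one)

  lexSup-maximal : ∀ {η s} → WitnessAt η s → lexSup η ≡ true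
  lexSup-maximal {η} {s} w = trans (lexSup-unfold η) (dec-true (lem _) (s , w))

  Target : Maybe Carrier → 2^ ξ → Set
  Target nothing  t = _≈seq_ ξ t lexSup
  Target (just η) t = AgreesBelow η t lexSup × t η ≡ true

  chosen : Maybe Carrier → Maybe (2^ ξ)
  chosen i = choose lem (λ t → C t × Target i t)

  open Enumeration lem (maybe-code code) (maybe-code-injective code-inj) chosen public

  listed-in-C : ∀ n t → enum n ≡ just t → C t
  listed-in-C n t listed with enum-values n listed
  ... | i , chosen-t = proj₁ (choose-sound lem _ chosen-t)

  listed-target : ∀ i → (∃[ s ] (C s × Target i s)) → ∃[ n ] ∃[ t ] (enum n ≡ just t × Target i t)
  listed-target i w with choose-complete lem _ w
  ... | t , chosen-t , (_ , target) = maybe-code code i , t , trans (enum-code i) chosen-t , target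

  -- Compare s with lexSup at their first difference; a 1 of s against a 0 of
  -- lexSup is impossible, a 0 of s against a 1 of lexSup is covered by a witness.
  cofinal : ∀ s → C s → ∃[ n ] ∃[ t ] (enum n ≡ just t × _≤lex_ ξ s t)
  cofinal s Cs with first-difference lem wf s lexSup
  ... | inj₂ s≈sup with listed-target nothing (s , Cs , s≈sup)
  ...   | n , t , listed , t≈sup = n , t , listed , inj₁ (λ η → trans (s≈sup η) (sym (t≈sup η)))
  cofinal s Cs | inj₁ (η , agree , s≢sup) with distinct-bools s≢sup
  ... | inj₂ (sη≡1 , supη≡0) = contradiction (trans (sym (lexSup-maximal (Cs , agree , sη≡1))) supη≡0) λ ()
  ... | inj₁ (sη≡0 , supη≡1) with listed-target (just η) (lexSup-witnessed supη≡1)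
  ...   | n , t , listed , (t-agree , tη≡1) =
          n , t , listed , inj₂ (η , ((λ ζ ζ<η → trans (agree ζ ζ<η) (sym (t-agree ζ ζ<η))) , sη≡0) , tη≡1)

lemma5 : LEM → (ξ : CountableOrdinal) → (C : 2^ ξ → Set) → CountablyCofinal ξ C
lemma5 lem ξ C = enum , listed-in-C , cofinal
  where open LexSupremum lem ξ C
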